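{- Let $G$ be a brick or brace of perfect matching width $2$ and $(T,\delta)$ a PM-decomposition of $G$ of width $2$. Then the spine of $T$ is cubic.
   Context: All graphs are finite and simple. $\mathcal{M}(G)$ is the set of perfect matchings of $G$; $G$ is matching covered if connected and every edge lies in a perfect matching. For nonempty $X\subseteq V(G)$, $\partial(X)$ is the set of edges with exactly one endpoint in $X$, and $\operatorname{mp}(\partial(X))=\max_{M\in\mathcal{M}(G)}|M\cap\partial(X)|$. A PM-decomposition of $G$ is a pair $(T,\delta)$ with $T$ a cubic tree (all non-leaf vertices of degree 3) and $\delta$ a bijection from the leaves of $T$ to $V(G)$; each edge of $T$ splits the leaves into two sets whose $\delta$-images $X_1,X_2$ partition $V(G)$ and induces the cut $\partial(X_1)$; the width is the maximum matching porosity of these cuts and $\operatorname{pmw}(G)$ is the minimum width of a PM-decomposition. The spine of $T$ is the tree obtained from $T$ by deleting all leaves. A cut $\partial(Z)$ is tight if $|M\cap\partial(Z)|=1$ for all $M\in\mathcal{M}(G)$, nontrivial if both shores have at least two vertices; a brace (resp. brick) is a bipartite (resp. non-bipartite) matching covered graph with no nontrivial tight cut. -}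

module Defs where

open import Data.Nat using (ℕ; zero; suc; _+_; _≤_)
open import Data.Bool using (Bool; true; false; if_then_else_; _∧_; not)
open import Data.Fin using (Fin; zero; suc; inject₁; fromℕ)
open import Data.Product using (Σ; _×_; ∃)
open import Data.Sum using (_⊎_)
open import Relation.Nullary using (¬_)
open import Relation.Binary.PropositionalEquality using (_≡_; _≢_)
open import Relation.Binary.Construct.Closure.ReflexiveTransitive using (Star)
open import Function using (_∘_)
open import Function.Definitions using (Injective)

countF : ∀ {n} → (Fin n → Bool) → ℕ
countF {zero}  f = 0
countF {suc n} f = (if f zero then 1 else 0) + countF (f ∘ suc)

record Graph (n : ℕ) : Set where
  field
    adj    : Fin n → Fin n → Bool
    sym    : ∀ u v → adj u v ≡ adj v u
    irrefl : ∀ u → adj u u ≡ false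
open Graph public

Adj : ∀ {n} → Graph n → Fin n → Fin n → Set
Adj G u v = adj G u v ≡ true

deg : ∀ {n} → Graph n → Fin n → ℕ
deg G v = countF (adj G v)

Connected : ∀ {n} → Graph n → Set
Connected G = ∀ u v → Star (Adj G) u v

-- a cycle of length k+3: distinct vertices c₀ … c_{k+2}, consecutive ones adjacent, closing up
record Cycle {n : ℕ} (G : Graph n) : Set where
  field
    len    : ℕ
    cyc    : Fin (suc (suc (suc len))) → Fin n
    inj    : Injective _≡_ _≡_ cyc
    step   : ∀ (i : Fin (suc (suc len))) → Adj G (cyc (inject₁ i)) (cyc (suc i))
    close  : Adj G (cyc (fromℕ (suc (suc len)))) (cyc zero)

IsTree : ∀ {n} → Graph n → Set
IsTree G = Connected G × ¬ Cycle G

IsCubicTree : ∀ {n} → Graph n → Set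
IsCubicTree G = IsTree G × (∀ v → deg G v ≢ 1 → deg G v ≡ 3)

IsLeaf : ∀ {m} → Graph m → Fin m → Set
IsLeaf T v = deg T v ≡ 1

-- Perfect matchings, represented by the mate function (a fixed-point-free
-- involution along edges of G)

record PerfectMatching {n : ℕ} (G : Graph n) : Set where
  field
    mate     : Fin n → Fin n
    mate-adj : ∀ u → Adj G u (mate u)
    mate-inv : ∀ u → mate (mate u) ≡ u
open PerfectMatching public

-- |M ∩ ∂(X)| : number of matching edges with exactly one end in X
-- (counted by their endpoint lying in X)
crossing : ∀ {n} {G : Graph n} → (Fin n → Bool) → PerfectMatching G → ℕ
crossing X M = countF (λ u → X u ∧ not (X (mate M u)))

MpLE : ∀ {n} (G : Graph n) → (Fin n → Bool) → ℕ → Set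
MpLE G X k = ∀ (M : PerfectMatching G) → crossing X M ≤ k

MatchingCovered : ∀ {n} → Graph n → Set
MatchingCovered G =
  Connected G × (∀ u v → Adj G u v → Σ (PerfectMatching G) λ M → mate M u ≡ v)

Tight : ∀ {n} (G : Graph n) → (Fin n → Bool) → Set
Tight G X = ∀ (M : PerfectMatching G) → crossing X M ≡ 1

Nontrivial : ∀ {n} → (Fin n → Bool) → Set
Nontrivial X = (2 ≤ countF X) × (2 ≤ countF (not ∘ X))

NoNontrivialTightCut : ∀ {n} → Graph n → Set
NoNontrivialTightCut G = ∀ X → Nontrivial X → ¬ Tight G X

Bipartite : ∀ {n} → Graph n → Set
Bipartite {n} G = Σ (Fin n → Bool) λ c → ∀ u v → Adj G u v → c u ≢ c v

IsBrace : ∀ {n} → Graph n → Set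
IsBrace G = MatchingCovered G × Bipartite G × NoNontrivialTightCut G

IsBrick : ∀ {n} → Graph n → Set
IsBrick G = MatchingCovered G × ¬ Bipartite G × NoNontrivialTightCut G

-- PM-decompositions. The bijection δ : leaves(T) → V(G) is given by its
-- inverse `leafOf : V(G) → V(T)`, injective, landing in leaves, hitting every leaf.

record PMDecomposition {n : ℕ} (G : Graph n) : Set where
  field
    m        : ℕ
    T        : Graph m
    cubic    : IsCubicTree T
    leafOf   : Fin n → Fin m
    leafOf-inj  : Injective _≡_ _≡_ leafOf
    leafOf-leaf : ∀ x → IsLeaf T (leafOf x)
    leafOf-onto : ∀ v → IsLeaf T v → Σ (Fin n) λ x → leafOf x ≡ v
open PMDecomposition public

StepAvoid : ∀ {m} → Graph m → Fin m → Fin m → Fin m → Fin m → Set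
StepAvoid T a b u w = Adj T u w × ¬ (u ≡ a × w ≡ b) × ¬ (u ≡ b × w ≡ a)

-- X is the shore δ(leaves on a's side of T - ab) of the cut induced by the edge ab
InducedShore : ∀ {n} {G : Graph n} (D : PMDecomposition G) →
               Fin (m D) → Fin (m D) → (Fin n → Bool) → Set
InducedShore D a b X =
  ∀ x → (X x ≡ true → Star (StepAvoid (T D) a b) a (leafOf D x))
      × (Star (StepAvoid (T D) a b) a (leafOf D x) → X x ≡ true)

WidthLE : ∀ {n} {G : Graph n} → PMDecomposition G → ℕ → Set
WidthLE {G = G} D k =
  ∀ a b → Adj (T D) a b → ∀ X → InducedShore D a b X → MpLE G X k

WidthEq : ∀ {n} {G : Graph n} → PMDecomposition G → ℕ → Set
WidthEq D k = WidthLE D k × ¬ WidthLE D (Data.Nat.pred k)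

PmwEq : ∀ {n} → Graph n → ℕ → Set
PmwEq G k = (Σ (PMDecomposition G) λ D → WidthLE D k)
          × (∀ (D : PMDecomposition G) → ¬ WidthLE D (Data.Nat.pred k))

-- degree of a spine vertex inside the spine (T minus its leaves)
spineDeg : ∀ {m} → Graph m → Fin m → ℕ
spineDeg T v = countF (λ w → adj T v w ∧ not (Data.Nat._≡ᵇ_ (deg T w) 1))

SpineCubic : ∀ {m} → Graph m → Set
SpineCubic T = ∀ v → ¬ IsLeaf T v → spineDeg T v ≢ 1 → spineDeg T v ≡ 3

-- Let v be a vertex of T of degree 3 with neighbours x, y, z, and let S_w be the shore of the
-- cut induced by the tree edge wv. Every vertex of G lies beyond exactly one neighbour of v,
-- so |V(G)| = |S_x| + |S_y| + |S_z|. If w is a leaf then |S_w| = 1. Otherwise both S_w and its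
-- complement contain two vertices (leaves of T beyond w, resp. beyond the other two neighbours),
-- and |S_w| is even: a perfect matching meets ∂(S_w) in a number of edges of the parity of |S_w|,
-- so an odd shore of matching porosity at most 2 would be a nontrivial tight cut. As |V(G)| is
-- even, v has an even number of leaf neighbours, i.e. 1 or 3 neighbours in the spine.

module Submission where

open import Defs hiding (sym)
open import Algebra.Bundles using (CommutativeMonoid)
import Data.Bool as Bool
open import Data.Bool using (Bool; true; false; not; _∧_; _xor_; if_then_else_)
open import Data.Bool.Properties
  using (∧-comm; ∧-identityʳ; ∧-zeroʳ; ¬-not; not-involutive; not-distribˡ-xor; ∧-commutativeMonoid)
open import Data.Empty using (⊥; ⊥-elim)
open import Data.Fin using (Fin; zero; suc; _≟_; toℕ; fromℕ<)
open import Data.Fin.Properties as Fin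
  using (any?; pigeonhole; toℕ<n; toℕ-fromℕ<; toℕ-injective; toℕ-inject₁; toℕ-fromℕ)
open import Data.Nat as ℕ using (ℕ; zero; suc; _+_; _≤_; _<_; _≡ᵇ_; s≤s; z≤n)
open import Data.Nat.Properties
  using (≡ᵇ⇒≡; +-identityʳ; +-suc; suc-injective; ≤-pred; ≤-refl; ≤-trans; n≤1+n; ≮⇒≥; <-irrefl; +-commutativeSemigroup)
open import Data.Product using (Σ; _×_; _,_; proj₁; proj₂)
open import Data.Sum using (_⊎_; inj₁; inj₂; [_,_]′)
open import Data.Unit using (tt)
open import Function using (_∘_; id; case_of_)
open import Relation.Binary.Construct.Closure.ReflexiveTransitive using (Star; ε; _◅_; _◅◅_; reverse)
open import Relation.Binary.PropositionalEquality
  using (_≡_; _≢_; refl; sym; trans; cong; cong₂; subst; module ≡-Reasoning)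
open import Relation.Nullary using (¬_; Dec; yes; no; does)
open import Relation.Nullary.Decidable using (_×-dec_; dec-true; dec-false)

open import Algebra.Properties.CommutativeSemigroup +-commutativeSemigroup using (interchange)
import Algebra.Properties.CommutativeSemigroup (CommutativeMonoid.commutativeSemigroup ∧-commutativeMonoid) as ∧

private variable n : ℕ

-- Counting

bit : Bool → ℕ
bit b = if b then 1 else 0

_≐_ : Fin n → Fin n → Bool
i ≐ j = does (i ≟ j)

≐-refl : (i : Fin n) → (i ≐ i) ≡ true
≐-refl i = dec-true (i ≟ i) refl

≐⇒≡ : {i j : Fin n} → (i ≐ j) ≡ true → i ≡ j
≐⇒≡ {i = i} {j} e with i ≟ j
... | yes i≡j = i≡j

remove : (Fin n → Bool) → Fin n → Fin n → Bool
remove f i u = f u ∧ not (u ≐ i)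

remove-≢ : (f : Fin n → Bool) {i u : Fin n} → u ≢ i → remove f i u ≡ f u
remove-≢ f {i} {u} u≢i = trans (cong (λ b → f u ∧ not b) (dec-false (u ≟ i) u≢i)) (∧-identityʳ (f u))

remove-supported : (f : Fin n → Bool) (i : Fin n) {u : Fin n} → (f u ≡ true → u ≡ i) → remove f i u ≡ false
remove-supported f i {u} only-i with u ≟ i
... | yes _   = ∧-zeroʳ (f u)
... | no u≢i  rewrite ¬-not (u≢i ∘ only-i) = refl

remove-true : (f : Fin n → Bool) {i u : Fin n} → remove f i u ≡ true → f u ≡ true × u ≢ i
remove-true f {i} {u} e with f u | u ≟ i
... | true | no u≢i = refl , u≢i

countF-cong : {f g : Fin n → Bool} → (∀ u → f u ≡ g u) → countF f ≡ countF g
countF-cong {zero}  f≗g = refl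
countF-cong {suc n} f≗g = cong₂ (λ b c → bit b + c) (f≗g zero) (countF-cong (f≗g ∘ suc))

countF-sum : (f g h : Fin n → Bool) → (∀ u → bit (f u) + bit (g u) ≡ bit (h u)) →
             countF f + countF g ≡ countF h
countF-sum {zero}  f g h pointwise = refl
countF-sum {suc n} f g h pointwise =
  trans (interchange (bit (f zero)) (countF (f ∘ suc)) (bit (g zero)) (countF (g ∘ suc)))
        (cong₂ _+_ (pointwise zero) (countF-sum (f ∘ suc) (g ∘ suc) (h ∘ suc) (pointwise ∘ suc)))

countF-split : (f g : Fin n → Bool) → countF f ≡ countF (λ u → f u ∧ g u) + countF (λ u → f u ∧ not (g u))
countF-split f g = sym (countF-sum _ _ f (λ u → split (f u) (g u)))
  where
  split : ∀ a b → bit (a ∧ b) + bit (a ∧ not b) ≡ bit a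
  split true  true  = refl
  split true  false = refl
  split false b     = refl

countF-all-false : {f : Fin n → Bool} → (∀ u → f u ≡ false) → countF f ≡ 0
countF-all-false {zero}  none = refl
countF-all-false {suc n} none rewrite none zero = countF-all-false (none ∘ suc)

countF-all-true : {f : Fin n → Bool} → (∀ u → f u ≡ true) → countF f ≡ n
countF-all-true {zero}  all = refl
countF-all-true {suc n} all rewrite all zero = cong suc (countF-all-true (all ∘ suc))

countF-supported-at : {f : Fin n → Bool} (i : Fin n) → (∀ u → f u ≡ true → u ≡ i) → countF f ≡ bit (f i)
countF-supported-at {suc n} {f} zero only-i =
  trans (cong (bit (f zero) +_) (countF-all-false outside)) (+-identityʳ (bit (f zero)))
  where
  outside : ∀ u → f (suc u) ≡ false
  outside u with f (suc u) in e
  ... | false = refl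
  ... | true with () ← only-i (suc u) e
countF-supported-at {suc n} {f} (suc i) only-i with f zero in e
... | true  with () ← only-i zero e
... | false = countF-supported-at i (λ u e′ → Fin.suc-injective (only-i (suc u) e′))

countF-at : (g : Fin n → Bool) (i : Fin n) → countF (λ u → g u ∧ (u ≐ i)) ≡ bit (g i)
countF-at g i = trans (countF-supported-at i at-i) (cong bit (trans (cong (g i ∧_) (≐-refl i)) (∧-identityʳ (g i))))
  where
  at-i : ∀ u → g u ∧ (u ≐ i) ≡ true → u ≡ i
  at-i u e with g u
  ... | true = ≐⇒≡ e

countF-remove : (f : Fin n → Bool) {i : Fin n} → f i ≡ true → countF f ≡ suc (countF (remove f i))
countF-remove f {i} fi =
  trans (countF-split f (_≐ i)) (cong (_+ countF (remove f i)) (trans (countF-at f i) (cong bit fi)))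

countF-∧-remove : (f h : Fin n → Bool) {i : Fin n} → f i ≡ true →
                  countF (λ u → f u ∧ h u) ≡ bit (h i) + countF (λ u → remove f i u ∧ h u)
countF-∧-remove f h {i} fi = trans (countF-split _ (_≐ i)) (cong₂ _+_ at-i (countF-cong reorder))
  where
  at-i : countF (λ u → (f u ∧ h u) ∧ (u ≐ i)) ≡ bit (h i)
  at-i = trans (countF-at _ i) (cong (λ b → bit (b ∧ h i)) fi)
  reorder : ∀ u → (f u ∧ h u) ∧ not (u ≐ i) ≡ remove f i u ∧ h u
  reorder u = ∧.xy∙z≈xz∙y (f u) (h u) (not (u ≐ i))

countF-choose : {f : Fin n → Bool} {k : ℕ} → countF f ≡ suc k → Σ (Fin n) λ i → f i ≡ true
countF-choose {suc n} {f} e with f zero in f0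
... | true  = zero , f0
... | false = let i , fi = countF-choose e in suc i , fi

countF-suc⇒remove : {f : Fin n → Bool} {k : ℕ} → countF f ≡ suc k →
       Σ (Fin n) λ i → f i ≡ true × countF (remove f i) ≡ k
countF-suc⇒remove {f = f} c = let i , fi = countF-choose c in i , fi , suc-injective (trans (sym (countF-remove f fi)) c)

countF-false : {f : Fin n → Bool} → countF f ≡ 0 → ∀ u → f u ≡ false
countF-false {f = f} e u with f u in fu
... | false = refl
... | true with () ← trans (sym e) (countF-remove f fu)

two≤countF : {f : Fin n → Bool} {i j : Fin n} → f i ≡ true → f j ≡ true → i ≢ j → 2 ≤ countF f
two≤countF {f = f} {i} {j} fi fj i≢j
  rewrite countF-remove f fi | countF-remove (remove f i) (trans (remove-≢ f (i≢j ∘ sym)) fj) = s≤s (s≤s z≤n)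

≐-one-hot : {x y z b : Fin n} → x ≢ y → y ≢ z → z ≢ x → b ≡ x ⊎ b ≡ y ⊎ b ≡ z →
            bit (b ≐ x) + (bit (b ≐ y) + bit (b ≐ z)) ≡ 1
≐-one-hot {x = x} {y} {z} x≢y y≢z z≢x (inj₁ refl)
  rewrite ≐-refl x | dec-false (x ≟ y) x≢y | dec-false (x ≟ z) (z≢x ∘ sym) = refl
≐-one-hot {x = x} {y} {z} x≢y y≢z z≢x (inj₂ (inj₁ refl))
  rewrite ≐-refl y | dec-false (y ≟ x) (x≢y ∘ sym) | dec-false (y ≟ z) y≢z = refl
≐-one-hot {x = x} {y} {z} x≢y y≢z z≢x (inj₂ (inj₂ refl))
  rewrite ≐-refl z | dec-false (z ≟ x) z≢x | dec-false (z ≟ y) (y≢z ∘ sym) = refl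

countF-partition₃ : (f g h : Fin n → Bool) → (∀ u → bit (f u) + (bit (g u) + bit (h u)) ≡ 1) →
                    countF f + (countF g + countF h) ≡ n
countF-partition₃ {zero}  f g h one = refl
countF-partition₃ {suc n} f g h one = begin
  (bit (f zero) + F) + ((bit (g zero) + G′) + (bit (h zero) + H))
    ≡⟨ cong ((bit (f zero) + F) +_) (interchange (bit (g zero)) G′ (bit (h zero)) H) ⟩
  (bit (f zero) + F) + ((bit (g zero) + bit (h zero)) + (G′ + H))
    ≡⟨ interchange (bit (f zero)) F (bit (g zero) + bit (h zero)) (G′ + H) ⟩
  (bit (f zero) + (bit (g zero) + bit (h zero))) + (F + (G′ + H))
    ≡⟨ cong₂ _+_ (one zero) (countF-partition₃ (f ∘ suc) (g ∘ suc) (h ∘ suc) (one ∘ suc)) ⟩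
  suc n ∎
  where
  open ≡-Reasoning
  F = countF (f ∘ suc)
  G′ = countF (g ∘ suc)
  H = countF (h ∘ suc)

record Three (f : Fin n → Bool) : Set where
  field
    x y z    : Fin n
    fx       : f x ≡ true
    fy       : f y ≡ true
    fz       : f z ≡ true
    x≢y      : x ≢ y
    y≢z      : y ≢ z
    z≢x      : z ≢ x
    covers   : ∀ u → f u ≡ true → u ≡ x ⊎ u ≡ y ⊎ u ≡ z

rotate : {f : Fin n → Bool} → Three f → Three f
rotate t = record
  { x = y ; y = z ; z = x ; fx = fy ; fy = fz ; fz = fx ; x≢y = y≢z ; y≢z = z≢x ; z≢x = x≢y
  ; covers = λ u fu → shift (covers u fu) }
  where
  open Three t
  shift : ∀ {u} → u ≡ x ⊎ u ≡ y ⊎ u ≡ z → u ≡ y ⊎ u ≡ z ⊎ u ≡ x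
  shift (inj₁ e)        = inj₂ (inj₂ e)
  shift (inj₂ (inj₁ e)) = inj₁ e
  shift (inj₂ (inj₂ e)) = inj₂ (inj₁ e)

three-starting-at : {f : Fin n → Bool} (t : Three f) {v : Fin n} → f v ≡ true →
                    Σ (Three f) λ t′ → Three.x t′ ≡ v
three-starting-at t {v} fv with Three.covers t v fv
... | inj₁ e        = t , sym e
... | inj₂ (inj₁ e) = rotate t , sym e
... | inj₂ (inj₂ e) = rotate (rotate t) , sym e

three-of-count : {f : Fin n → Bool} → countF f ≡ 3 → Three f
three-of-count {f = f} c₃ with countF-suc⇒remove c₃
... | x , fx , c₂ with countF-suc⇒remove c₂
...   | y , gy , c₁ with countF-suc⇒remove c₁
...     | z , hz , c₀ = record
  { x = x ; y = y ; z = z ; fx = fx ; fy = fy ; fz = fz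
  ; x≢y = y≢x ∘ sym ; y≢z = z≢y ∘ sym ; z≢x = z≢x ; covers = covers }
  where
  g = remove f x
  h = remove g y
  fy = proj₁ (remove-true f gy)
  y≢x = proj₂ (remove-true f gy)
  gz = proj₁ (remove-true g hz)
  z≢y = proj₂ (remove-true g hz)
  fz = proj₁ (remove-true f gz)
  z≢x = proj₂ (remove-true f gz)
  covers : ∀ u → f u ≡ true → u ≡ x ⊎ u ≡ y ⊎ u ≡ z
  covers u fu with u ≟ x | u ≟ y | u ≟ z
  ... | yes e | _ | _ = inj₁ e
  ... | no _ | yes e | _ = inj₂ (inj₁ e)
  ... | no _ | no _ | yes e = inj₂ (inj₂ e)
  ... | no u≢x | no u≢y | no u≢z with () ←
    trans (sym (countF-false c₀ u)) (trans (remove-≢ h u≢z) (trans (remove-≢ g u≢y) (trans (remove-≢ f u≢x) fu)))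

countF-∧-three : {f : Fin n → Bool} (t : Three f) (h : Fin n → Bool) →
                 countF (λ u → f u ∧ h u) ≡ bit (h (Three.x t)) + (bit (h (Three.y t)) + bit (h (Three.z t)))
countF-∧-three {f = f} t h = begin
  countF (λ u → f u ∧ h u)
    ≡⟨ countF-∧-remove f h fx ⟩
  bit (h x) + countF (λ u → g u ∧ h u)
    ≡⟨ cong (bit (h x) +_) (countF-∧-remove g h gy) ⟩
  bit (h x) + (bit (h y) + countF (λ u → k u ∧ h u))
    ≡⟨ cong (λ c → bit (h x) + (bit (h y) + c)) (countF-∧-remove k h kz) ⟩
  bit (h x) + (bit (h y) + (bit (h z) + countF (λ u → remove k z u ∧ h u)))
    ≡⟨ cong (λ c → bit (h x) + (bit (h y) + c)) (trans (cong (bit (h z) +_) (countF-all-false none)) (+-identityʳ _)) ⟩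
  bit (h x) + (bit (h y) + bit (h z)) ∎
  where
  open ≡-Reasoning
  open Three t
  g = remove f x
  k = remove g y
  gy : g y ≡ true
  gy = trans (remove-≢ f (x≢y ∘ sym)) fy
  kz : k z ≡ true
  kz = trans (remove-≢ g (y≢z ∘ sym)) (trans (remove-≢ f z≢x) fz)
  only-z : ∀ u → k u ≡ true → u ≡ z
  only-z u ku with remove-true g ku
  ... | gu , u≢y with remove-true f gu
  ...   | fu , u≢x = [ ⊥-elim ∘ u≢x , [ ⊥-elim ∘ u≢y , id ]′ ]′ (covers u fu)
  none : ∀ u → remove k z u ∧ h u ≡ false
  none u = cong (_∧ h u) (remove-supported k z (only-z u))

-- Parity

odd : ℕ → Bool
odd zero    = false
odd (suc k) = not (odd k)

odd-+ : ∀ a b → odd (a + b) ≡ odd a xor odd b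
odd-+ zero    b = refl
odd-+ (suc a) b = trans (cong not (odd-+ a b)) (not-distribˡ-xor (odd a) (odd b))

even-parity-of-three : ∀ a b c → a xor (b xor c) ≡ false →
                       bit (not a) + (bit (not b) + bit (not c)) ≡ 1 ⊎ bit (not a) + (bit (not b) + bit (not c)) ≡ 3
even-parity-of-three true  true  false _ = inj₁ refl
even-parity-of-three true  false true  _ = inj₁ refl
even-parity-of-three false true  true  _ = inj₁ refl
even-parity-of-three false false false _ = inj₂ refl

module _ {σ : Fin n → Fin n} (σ-involutive : ∀ u → σ (σ u) ≡ u) (σ-fixed-point-free : ∀ u → σ u ≢ u) where

  ≐-involution : ∀ w u → (σ w ≐ u) ≡ (w ≐ σ u)
  ≐-involution w u with w ≟ σ u
  ... | yes w≡σu = dec-true (σ w ≟ u) (trans (cong σ w≡σu) (σ-involutive u))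
  ... | no w≢σu  = dec-false (σ w ≟ u) (λ σw≡u → w≢σu (trans (sym (σ-involutive w)) (cong σ σw≡u)))

  private
    remove-pair : (P : Fin n → Bool) → Fin n → Fin n → Bool
    remove-pair P u = remove (remove P u) (σ u)

    remove-pair-invariant : (P : Fin n → Bool) → (∀ w → P (σ w) ≡ P w) →
                            ∀ u w → remove-pair P u (σ w) ≡ remove-pair P u w
    remove-pair-invariant P invariant u w = begin
      (P (σ w) ∧ not (σ w ≐ u)) ∧ not (σ w ≐ σ u)
        ≡⟨ cong₂ (λ a c → a ∧ not c) (cong₂ (λ a b → a ∧ not b) (invariant w) (≐-involution w u))
                 (trans (≐-involution w (σ u)) (cong (w ≐_) (σ-involutive u))) ⟩
      (P w ∧ not (w ≐ σ u)) ∧ not (w ≐ u)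
        ≡⟨ ∧.xy∙z≈xz∙y (P w) (not (w ≐ σ u)) (not (w ≐ u)) ⟩
      (P w ∧ not (w ≐ u)) ∧ not (w ≐ σ u) ∎
      where open ≡-Reasoning

  countF-even-if-invariant : (P : Fin n → Bool) → (∀ u → P (σ u) ≡ P u) → odd (countF P) ≡ false
  countF-even-if-invariant P invariant = go (countF P) P invariant refl
    where
    go : ∀ c (P : Fin n → Bool) → (∀ u → P (σ u) ≡ P u) → countF P ≡ c → odd c ≡ false
    go zero P invariant c = refl
    go (suc c) P invariant c+1 with countF-suc⇒remove c+1
    ... | u , Pu , c′ with c | trans (remove-≢ P (σ-fixed-point-free u)) (trans (invariant u) Pu)
    ...   | zero   | partner with () ← trans (sym (countF-false c′ (σ u))) partner
    ...   | suc c″ | partner =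
      trans (not-involutive (odd c″))
            (go c″ (remove-pair P u) (remove-pair-invariant P invariant u)
                (suc-injective (trans (sym (countF-remove (remove P u) partner)) c′)))

-- Perfect matchings

module _ {G : Graph n} where

  mate-≢ : (M : PerfectMatching G) (u : Fin n) → mate M u ≢ u
  mate-≢ M u mu≡u with () ← trans (sym (subst (Adj G u) mu≡u (mate-adj M u))) (irrefl G u)

  odd-crossing : (X : Fin n → Bool) (M : PerfectMatching G) → odd (crossing X M) ≡ odd (countF X)
  odd-crossing X M = sym (begin
    odd (countF X)                                   ≡⟨ cong odd (countF-split X (X ∘ mate M)) ⟩
    odd (countF inside + crossing X M)               ≡⟨ odd-+ (countF inside) (crossing X M) ⟩
    odd (countF inside) xor odd (crossing X M)       ≡⟨ cong (_xor odd (crossing X M)) inside-even ⟩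
    odd (crossing X M)                               ∎)
    where
    open ≡-Reasoning
    inside : Fin n → Bool
    inside u = X u ∧ X (mate M u)
    inside-even : odd (countF inside) ≡ false
    inside-even = countF-even-if-invariant (mate-inv M) (mate-≢ M) inside
      (λ u → trans (cong (X (mate M u) ∧_) (cong X (mate-inv M u))) (∧-comm (X (mate M u)) (X u)))

  even-order : PerfectMatching G → odd n ≡ false
  even-order M = begin
    odd n                                  ≡⟨ cong odd (countF-all-true {n} (λ _ → refl)) ⟨
    odd (countF {n} (λ _ → true))          ≡⟨ odd-crossing (λ _ → true) M ⟨
    odd (countF {n} (λ _ → false))         ≡⟨ cong odd (countF-all-false {n} (λ _ → refl)) ⟩
    false                                  ∎
    where open ≡-Reasoning

  tight-if-odd : (X : Fin n → Bool) → odd (countF X) ≡ true → MpLE G X 2 → Tight G X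
  tight-if-odd X odd-X mp≤2 M = odd≤2⇒1 (crossing X M) (trans (odd-crossing X M) odd-X) (mp≤2 M)
    where
    odd≤2⇒1 : ∀ c → odd c ≡ true → c ≤ 2 → c ≡ 1
    odd≤2⇒1 (suc zero)          _ _                 = refl
    odd≤2⇒1 (suc (suc (suc c))) _ (s≤s (s≤s ()))

  perfectMatching-exists : MatchingCovered G → {u w : Fin n} → u ≢ w → PerfectMatching G
  perfectMatching-exists (connected , covered) {u} {w} u≢w with connected u w
  ... | ε         = ⊥-elim (u≢w refl)
  ... | uu′ ◅ _   = proj₁ (covered _ _ uu′)

-- Walks

module _ {N : ℕ} {R : Fin N → Fin N → Set} where

  length : ∀ {s t} → Star R s t → ℕ
  length ε       = 0
  length (_ ◅ p) = suc (length p)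

  vertex : ∀ {s t} → Star R s t → ℕ → Fin N
  vertex {s} ε       k       = s
  vertex {s} (_ ◅ p) zero    = s
  vertex     (_ ◅ p) (suc k) = vertex p k

  vertex-zero : ∀ {s t} (p : Star R s t) → vertex p 0 ≡ s
  vertex-zero ε       = refl
  vertex-zero (_ ◅ p) = refl

  vertex-length : ∀ {s t} (p : Star R s t) → vertex p (length p) ≡ t
  vertex-length ε       = refl
  vertex-length (_ ◅ p) = vertex-length p

  vertex-step : ∀ {s t} (p : Star R s t) k → k < length p → R (vertex p k) (vertex p (suc k))
  vertex-step (r ◅ ε)     zero    _         = r
  vertex-step (r ◅ _ ◅ _) zero    _         = r
  vertex-step (_ ◅ p)     (suc k) (s≤s k<l) = vertex-step p k k<l

  Simple : ∀ {s t} → Star R s t → Set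
  Simple p = ∀ j k → j ≤ length p → k ≤ length p → vertex p j ≡ vertex p k → j ≡ k

  Visits : ∀ {s t} → Star R s t → Fin N → Set
  Visits p u = Σ ℕ λ k → k ≤ length p × vertex p k ≡ u

  visits? : ∀ {s t} (p : Star R s t) u → Dec (Visits p u)
  visits? p u with any? (λ (i : Fin (suc (length p))) → vertex p (toℕ i) ≟ u)
  ... | yes (i , e) = yes (toℕ i , ≤-pred (toℕ<n i) , e)
  ... | no none     = no λ (k , k≤l , e) →
    none (fromℕ< (s≤s k≤l) , subst (λ j → vertex p j ≡ u) (sym (toℕ-fromℕ< (s≤s k≤l))) e)

  simple-ε : ∀ {s} → Simple (ε {x = s})
  simple-ε zero zero _ _ _ = refl

  simple-tail : ∀ {s s′ t} (r : R s s′) (p : Star R s′ t) → Simple (r ◅ p) → Simple p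
  simple-tail r p simple j k j≤ k≤ e = suc-injective (simple (suc j) (suc k) (s≤s j≤) (s≤s k≤) e)

  simple-◅ : ∀ {s s′ t} (r : R s s′) (p : Star R s′ t) → Simple p → ¬ Visits p s → Simple (r ◅ p)
  simple-◅ r p simple fresh zero    zero    _       _       _ = refl
  simple-◅ r p simple fresh zero    (suc k) _       (s≤s k≤) e = ⊥-elim (fresh (k , k≤ , sym e))
  simple-◅ r p simple fresh (suc j) zero    (s≤s j≤) _       e = ⊥-elim (fresh (j , j≤ , e))
  simple-◅ r p simple fresh (suc j) (suc k) (s≤s j≤) (s≤s k≤) e = cong suc (simple j k j≤ k≤ e)

  drop : ∀ {s t} (p : Star R s t) k → Star R (vertex p k) t
  drop ε       k       = ε
  drop (r ◅ p) zero    = r ◅ p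
  drop (r ◅ p) (suc k) = drop p k

  simple-drop : ∀ {s t} (p : Star R s t) k → Simple p → Simple (drop p k)
  simple-drop ε       k       simple = simple-ε
  simple-drop (r ◅ p) zero    simple = simple
  simple-drop (r ◅ p) (suc k) simple = simple-drop p k (simple-tail r p simple)

  take : ∀ {s t} (p : Star R s t) k → Star R s (vertex p k)
  take ε       k       = ε
  take (r ◅ p) zero    = ε
  take (r ◅ p) (suc k) = r ◅ take p k

  length-take : ∀ {s t} (p : Star R s t) k → k ≤ length p → length (take p k) ≡ k
  length-take ε       zero    _        = refl
  length-take (r ◅ p) zero    _        = refl
  length-take (r ◅ p) (suc k) (s≤s k≤) = cong suc (length-take p k k≤)

  vertex-take : ∀ {s t} (p : Star R s t) k j → j ≤ k → vertex (take p k) j ≡ vertex p j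
  vertex-take ε       k       j       _        = refl
  vertex-take (r ◅ p) zero    zero    _        = refl
  vertex-take (r ◅ p) (suc k) zero    _        = refl
  vertex-take (r ◅ p) (suc k) (suc j) (s≤s j≤) = vertex-take p k j j≤

  simple-take : ∀ {s t} (p : Star R s t) k → k ≤ length p → Simple p → Simple (take p k)
  simple-take p k k≤ simple i j i≤ j≤ e =
    simple i j (≤-trans i≤k k≤) (≤-trans j≤k k≤)
           (trans (sym (vertex-take p k i i≤k)) (trans e (vertex-take p k j j≤k)))
    where
    i≤k = subst (i ≤_) (length-take p k k≤) i≤
    j≤k = subst (j ≤_) (length-take p k k≤) j≤

  simplify : ∀ {s t} → Star R s t → Σ (Star R s t) Simple
  simplify ε = ε , simple-ε
  simplify {s} (r ◅ p) with simplify p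
  ... | q , simple with visits? q s
  ...   | yes (k , _ , e) = subst (λ v → Σ (Star R v _) Simple) e (drop q k , simple-drop q k simple)
  ...   | no fresh        = r ◅ q , simple-◅ r q simple fresh

  simple-length< : ∀ {s t} (p : Star R s t) → Simple p → length p < N
  simple-length< p simple with N ℕ.<? suc (length p)
  ... | no N≮  = ≮⇒≥ N≮
  ... | yes N< with pigeonhole N< (λ i → vertex p (toℕ i))
  ...   | i , j , i<j , e = ⊥-elim (<-irrefl (simple (toℕ i) (toℕ j) (≤-pred (toℕ<n i)) (≤-pred (toℕ<n j)) e) i<j)

-- Sides of an edge

module GraphSides {m : ℕ} (T : Graph m) where

  adj-sym : ∀ {u w} → Adj T u w → Adj T w u
  adj-sym {u} {w} uw = trans (Graph.sym T w u) uw

  adj-≢ : ∀ {u w} → Adj T u w → u ≢ w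
  adj-≢ {u} uu refl with () ← trans (sym uu) (irrefl T u)

  Side : Fin m → Fin m → Fin m → Set
  Side a b = Star (StepAvoid T a b) a

  avoid-sym : ∀ {a b u w} → StepAvoid T a b u w → StepAvoid T a b w u
  avoid-sym (uw , ¬ab , ¬ba) = adj-sym uw , (λ (w≡a , u≡b) → ¬ba (u≡b , w≡a)) , (λ (w≡b , u≡a) → ¬ab (u≡a , w≡b))

  reverse-avoid : ∀ {a b s t} → Star (StepAvoid T a b) s t → Star (StepAvoid T a b) t s
  reverse-avoid = reverse avoid-sym

  step-avoid : ∀ {a b u w} → Adj T u w → (u ≡ a → w ≢ b) → (u ≡ b → w ≢ a) → StepAvoid T a b u w
  step-avoid uw ¬ab ¬ba = uw , (λ (u≡a , w≡b) → ¬ab u≡a w≡b) , (λ (u≡b , w≡a) → ¬ba u≡b w≡a)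

  neighbour-of-leaf : ∀ {l v w} → IsLeaf T l → Adj T l v → Adj T l w → w ≡ v
  neighbour-of-leaf {l} {v} {w} leaf lv lw with w ≟ v
  ... | yes w≡v = w≡v
  ... | no w≢v with () ← trans (sym (trans (remove-≢ (adj T l) w≢v) lw))
                               (countF-false (suc-injective (trans (sym (countF-remove (adj T l) lv)) leaf)) w)

  other-neighbour : ∀ {c p} → deg T c ≢ 1 → Adj T c p → Σ (Fin m) λ q → Adj T c q × q ≢ p
  other-neighbour {c} {p} ¬leaf cp with countF (remove (adj T c) p) in rest
  ... | zero  = ⊥-elim (¬leaf (trans (countF-remove (adj T c) cp) (cong suc rest)))
  ... | suc k = let q , q-rest = countF-choose rest in q , remove-true (adj T c) q-rest

  leaf-side : ∀ {l v z} → IsLeaf T l → Adj T l v → Side l v z → z ≡ l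
  leaf-side leaf lv ε = refl
  leaf-side leaf lv ((lw , ¬lv , _) ◅ _) = ⊥-elim (¬lv (refl , neighbour-of-leaf leaf lv lw))

  locate : ∀ {z v} → Star (Adj T) z v → z ≡ v ⊎ Σ (Fin m) λ w → Adj T v w × Side w v z
  locate ε = inj₁ refl
  locate {z} {v} (_◅_ {j = z′} zz′ p) with locate p
  ... | inj₁ refl = inj₂ (z , adj-sym zz′ , ε)
  ... | inj₂ (w , vw , side) with (z′ ≟ w) ×-dec (z ≟ v) | (z′ ≟ v) ×-dec (z ≟ w)
  ...   | yes (_ , z≡v) | _              = inj₁ z≡v
  ...   | no _          | yes (_ , refl) = inj₂ (z , vw , ε)
  ...   | no ¬wv        | no ¬vw         = inj₂ (w , vw , side ◅◅ (adj-sym zz′ , ¬wv , ¬vw) ◅ ε)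

  avoids-or-crosses : ∀ {a b c d s t} → Star (StepAvoid T a b) s t →
                      Star (StepAvoid T c d) s t
                      ⊎ (Star (StepAvoid T a b) s c × Star (StepAvoid T a b) d t)
                      ⊎ (Star (StepAvoid T a b) s d × Star (StepAvoid T a b) c t)
  avoids-or-crosses ε = inj₁ ε
  avoids-or-crosses {c = c} {d} {s} (_◅_ {j = s′} r p) with avoids-or-crosses {c = c} {d} p
  ... | inj₂ (inj₁ (pre , suf)) = inj₂ (inj₁ (r ◅ pre , suf))
  ... | inj₂ (inj₂ (pre , suf)) = inj₂ (inj₂ (r ◅ pre , suf))
  ... | inj₁ p′ with (s ≟ c) ×-dec (s′ ≟ d) | (s ≟ d) ×-dec (s′ ≟ c)
  ...   | yes (refl , refl) | _                 = inj₂ (inj₁ (ε , p))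
  ...   | no _              | yes (refl , refl) = inj₂ (inj₂ (ε , p))
  ...   | no ¬cd            | no ¬dc            = inj₁ ((proj₁ r , ¬cd , ¬dc) ◅ p′)

  avoid-unvisited : ∀ {a b s t} (p : Star (Adj T) s t) → (∀ j → j ≤ length p → vertex p j ≢ b) →
                    Star (StepAvoid T a b) s t
  avoid-unvisited ε       _       = ε
  avoid-unvisited (r ◅ p) ¬visits =
    step-avoid r (λ _ e → ¬visits 1 (s≤s z≤n) (trans (vertex-zero p) e)) (λ e _ → ¬visits 0 z≤n e)
    ◅ avoid-unvisited p (λ j j≤ → ¬visits (suc j) (s≤s j≤))

  module _ (acyclic : ¬ Cycle T) where

    no-closed-simple-walk : ∀ {R : Fin m → Fin m → Set} → (∀ {u w} → R u w → Adj T u w) →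
                            ∀ {s t} (p : Star R s t) → Simple p → 2 ≤ length p → ¬ Adj T t s
    no-closed-simple-walk edge ε       _ ()
    no-closed-simple-walk edge (_ ◅ ε) _ (s≤s ())
    no-closed-simple-walk edge p@(_ ◅ _ ◅ q) simple _ ts = acyclic record
      { len   = length q
      ; cyc   = λ i → vertex p (toℕ i)
      ; inj   = λ {i} {j} e → toℕ-injective (simple (toℕ i) (toℕ j) (≤-pred (toℕ<n i)) (≤-pred (toℕ<n j)) e)
      ; step  = λ i → subst (λ k → Adj T (vertex p k) (vertex p (suc (toℕ i)))) (sym (toℕ-inject₁ i))
                            (edge (vertex-step p (toℕ i) (toℕ<n i)))
      ; close = subst (λ z → Adj T z _) (sym (trans (cong (vertex p) (toℕ-fromℕ (length p))) (vertex-length p))) ts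
      }

    no-detour : ∀ {s t} → Adj T s t → ¬ Star (StepAvoid T s t) s t
    no-detour st p with simplify p
    ... | ε                 , _      = adj-≢ st refl
    ... | (_ , ¬st , _) ◅ ε , _      = ¬st (refl , refl)
    ... | q@(_ ◅ _ ◅ _)     , simple = no-closed-simple-walk proj₁ q simple (s≤s (s≤s z≤n)) (adj-sym st)

    sides-disjoint : ∀ {a b v z} → Adj T a v → Adj T b v → a ≢ b → Side a v z → Side b v z → ⊥
    sides-disjoint {a} {b} {v} av bv a≢b za zb with avoids-or-crosses {c = a} {v} (reverse-avoid zb)
    ... | inj₁ zb′             = no-detour av (za ◅◅ zb′ ◅◅ bv′ ◅ ε)
      where bv′ = step-avoid bv (λ b≡a _ → a≢b (sym b≡a)) (λ b≡v _ → adj-≢ bv b≡v)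
    ... | inj₂ (inj₁ (_ , vb)) = no-detour bv (reverse-avoid vb)
    ... | inj₂ (inj₂ (_ , ab)) = no-detour bv (reverse-avoid (va ◅ ab))
      where va = step-avoid (adj-sym av) (λ v≡b → ⊥-elim (adj-≢ bv (sym v≡b))) (λ _ a≡b → a≢b a≡b)

    side-transfer : ∀ {a c v t} → Adj T a c → Adj T a v → c ≢ v → Side c a t → Side a v t
    side-transfer {a} {c} {v} ac av c≢v ct with avoids-or-crosses {c = a} {v} ct
    ... | inj₁ ct′ = step-avoid ac (λ _ → c≢v) (λ a≡v _ → adj-≢ av a≡v) ◅ ct′
    ... | inj₂ (inj₁ (ca , _)) = ⊥-elim (no-detour (adj-sym ac) ca)
    ... | inj₂ (inj₂ (cv , _)) = ⊥-elim (no-detour (adj-sym ac) (cv ◅◅ va ◅ ε))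
      where
      va : StepAvoid T c a v a
      va = step-avoid (adj-sym av) (λ v≡c → ⊥-elim (c≢v (sym v≡c))) (λ v≡a → ⊥-elim (adj-≢ av (sym v≡a)))

    side-≢ : ∀ {w v z} → Adj T w v → Side w v z → z ≢ v
    side-≢ wv wz refl = no-detour wv wz

    side-unique : ∀ {w w′ v z} → Adj T w v → Adj T w′ v → Side w v z → Side w′ v z → w ≡ w′
    side-unique {w} {w′} wv w′v wz w′z with w ≟ w′
    ... | yes w≡w′ = w≡w′
    ... | no w≢w′  = ⊥-elim (sides-disjoint wv w′v w≢w′ wz w′z)

    -- Walking away from w without ever stepping back stays simple in a forest, so it reaches
    -- a leaf within m steps.
    module _ {u w : Fin m} where

      record Trail (c : Fin m) : Set where
        field
          walk        : Star (Adj T) c w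
          simple      : Simple walk
          penultimate : Σ ℕ λ k → suc k ≡ length walk × vertex walk k ≡ u

      trail-side : ∀ {c} → Trail c → Side u w c
      trail-side {c} record { walk = walk ; simple = simple ; penultimate = k , 1+k≡l , at-k≡u } =
        reverse-avoid (subst (Star _ c) at-k≡u (avoid-unvisited (take walk k) misses-w))
        where
        k≤l : k ≤ length walk
        k≤l = subst (k ≤_) 1+k≡l (n≤1+n k)
        misses-w : ∀ j → j ≤ length (take walk k) → vertex (take walk k) j ≢ w
        misses-w j j≤ at-j≡w = <-irrefl j≡l (s≤s j≤k)
          where
          j≤k = subst (j ≤_) (length-take walk k k≤l) j≤
          j≡l : j ≡ suc k
          j≡l = trans (simple j (length walk) (≤-trans j≤k k≤l) ≤-refl
                        (trans (sym (vertex-take walk k j j≤k)) (trans at-j≡w (sym (vertex-length walk)))))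
                      (sym 1+k≡l)

      trail-extension : ∀ {c} (trail : Trail c) → deg T c ≢ 1 →
                        Σ (Fin m) λ q → Adj T c q × ¬ Visits (Trail.walk trail) q
      trail-extension {c} record { walk = walk ; simple = simple ; penultimate = k , 1+k≡l , _ } ¬leaf
        with other-neighbour ¬leaf (subst (λ z → Adj T z (vertex walk 1)) (vertex-zero walk)
                                          (vertex-step walk 0 (subst (0 <_) 1+k≡l (s≤s z≤n))))
      ... | q , cq , q≢next with visits? walk q
      ...   | no fresh                  = q , cq , fresh
      ...   | yes (zero , _ , at-0≡q)   = ⊥-elim (adj-≢ cq (trans (sym (vertex-zero walk)) at-0≡q))
      ...   | yes (suc zero , _ , at-1≡q) = ⊥-elim (q≢next (sym at-1≡q))
      ...   | yes (suc (suc j) , j≤ , at-j≡q) =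
        ⊥-elim (no-closed-simple-walk id (take walk (2 + j)) (simple-take walk (2 + j) j≤ simple)
                  (subst (2 ≤_) (sym (length-take walk (2 + j) j≤)) (s≤s (s≤s z≤n)))
                  (subst (λ z → Adj T z c) (sym at-j≡q) (adj-sym cq)))

      record LeafBeyond : Set where
        field
          leaf    : Fin m
          is-leaf : IsLeaf T leaf
          side    : Side u w leaf

      extend : ∀ {c q} (trail : Trail c) → Adj T q c → ¬ Visits (Trail.walk trail) q → Trail q
      extend trail qc fresh = record
        { walk        = qc ◅ walk
        ; simple      = simple-◅ qc walk simple fresh
        ; penultimate = let k , 1+k≡l , at-k≡u = penultimate in suc k , cong suc 1+k≡l , at-k≡u }
        where open Trail trail

      leaf-on-side : Adj T u w → LeafBeyond
      leaf-on-side uw = search m start (n≤1+n m)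
        where
        start : Trail u
        start = record
          { walk = uw ◅ ε
          ; simple = simple-◅ uw ε (simple-ε {R = Adj T}) (λ (_ , _ , w≡u) → adj-≢ uw (sym w≡u))
          ; penultimate = 0 , refl , refl }
        search : ∀ fuel {c} (trail : Trail c) → m ≤ length (Trail.walk trail) + fuel → LeafBeyond
        search zero trail bound =
          ⊥-elim (<-irrefl refl (≤-trans (simple-length< _ (Trail.simple trail)) (subst (m ≤_) (+-identityʳ _) bound)))
        search (suc fuel) {c} trail bound with deg T c ℕ.≟ 1
        ... | yes leaf = record { leaf = c ; is-leaf = leaf ; side = trail-side trail }
        ... | no ¬leaf with trail-extension trail ¬leaf
        ...   | q , cq , fresh = search fuel (extend trail (adj-sym cq) fresh) (subst (m ≤_) (+-suc _ fuel) bound)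

    record LeafPair (a v : Fin m) : Set where
      field
        l₁ l₂    : Fin m
        leaf₁    : IsLeaf T l₁
        leaf₂    : IsLeaf T l₂
        l₁≢l₂    : l₁ ≢ l₂
        side₁    : Side a v l₁
        side₂    : Side a v l₂

    two-leaves-on-side : ∀ {a v} → deg T a ≡ 3 → Adj T a v → LeafPair a v
    two-leaves-on-side {a} {v} deg≡3 av = record
      { l₁ = Y.leaf ; l₂ = Z.leaf ; leaf₁ = Y.is-leaf ; leaf₂ = Z.is-leaf
      ; l₁≢l₂ = λ l₁≡l₂ → sides-disjoint (adj-sym fy) (adj-sym fz) y≢z Y.side (subst (Side z a) (sym l₁≡l₂) Z.side)
      ; side₁ = side-transfer fy av (λ y≡v → x≢y (trans x≡v (sym y≡v))) Y.side
      ; side₂ = side-transfer fz av (λ z≡v → z≢x (trans z≡v (sym x≡v))) Z.side }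
      where
      neighbours = three-starting-at (three-of-count deg≡3) av
      open Three (proj₁ neighbours)
      x≡v = proj₂ neighbours
      module Y = LeafBeyond {y} {a} (leaf-on-side (adj-sym fy))
      module Z = LeafBeyond {z} {a} (leaf-on-side (adj-sym fz))

-- Shores around a vertex of a width-2 decomposition

module WidthTwo {n : ℕ} {G : Graph n} (matching-covered : MatchingCovered G)
                (no-tight-cut : NoNontrivialTightCut G) (D : PMDecomposition G) (width≤2 : WidthLE D 2) where

  open GraphSides (T D)
  open Three

  tree-connected : Connected (T D)
  tree-connected = proj₁ (proj₁ (cubic D))

  tree-acyclic : ¬ Cycle (T D)
  tree-acyclic = proj₂ (proj₁ (cubic D))

  non-leaf-degree : ∀ w → deg (T D) w ≢ 1 → deg (T D) w ≡ 3
  non-leaf-degree = proj₂ (cubic D)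

  vertexOf : ∀ {l} → IsLeaf (T D) l → Fin n
  vertexOf leaf = proj₁ (leafOf-onto D _ leaf)

  leafOf-vertexOf : ∀ {l} (leaf : IsLeaf (T D) l) → leafOf D (vertexOf leaf) ≡ l
  leafOf-vertexOf leaf = proj₂ (leafOf-onto D _ leaf)

  module _ {v : Fin (m D)} (deg-v≡3 : deg (T D) v ≡ 3) where

    -- The neighbour of v beyond which z lies; the value v at z = v is junk.
    branch : Fin (m D) → Fin (m D)
    branch z = [ (λ _ → v) , proj₁ ]′ (locate (tree-connected z v))

    branch-spec : ∀ z → z ≢ v → Adj (T D) v (branch z) × Side (branch z) v z
    branch-spec z z≢v with locate (tree-connected z v)
    ... | inj₁ z≡v          = ⊥-elim (z≢v z≡v)
    ... | inj₂ (_ , vw , side) = vw , side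

    leaf-≢-v : ∀ g → leafOf D g ≢ v
    leaf-≢-v g leaf≡v with () ← trans (sym (leafOf-leaf D g)) (trans (cong (deg (T D)) leaf≡v) deg-v≡3)

    branch-side : ∀ {w z} → Adj (T D) v w → Side w v z → branch z ≡ w
    branch-side vw wz =
      let vb , bz = branch-spec _ (side-≢ tree-acyclic (adj-sym vw) wz)
      in side-unique tree-acyclic (adj-sym vb) (adj-sym vw) bz wz

    shore : Fin (m D) → Fin n → Bool
    shore w g = branch (leafOf D g) ≐ w

    shore-of-side : ∀ {w w′ g} → Adj (T D) v w′ → Side w′ v (leafOf D g) → shore w g ≡ (w′ ≐ w)
    shore-of-side {w} vw′ side = cong (_≐ w) (branch-side vw′ side)

    shore-induced : ∀ {w} → Adj (T D) v w → InducedShore D w v (shore w)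
    shore-induced {w} vw g = in-side , in-shore
      where
      in-side : shore w g ≡ true → Side w v (leafOf D g)
      in-side b≡w = subst (λ b → Side b v (leafOf D g)) (≐⇒≡ b≡w) (proj₂ (branch-spec (leafOf D g) (leaf-≢-v g)))
      in-shore : Side w v (leafOf D g) → shore w g ≡ true
      in-shore side = trans (shore-of-side vw side) (≐-refl w)

    side-vertexOf : ∀ {w l} (leaf : IsLeaf (T D) l) → Side w v l → Side w v (leafOf D (vertexOf leaf))
    side-vertexOf {w} leaf = subst (Side w v) (sym (leafOf-vertexOf leaf))

    leaf-shore-size : ∀ {w} → Adj (T D) v w → IsLeaf (T D) w → countF (shore w) ≡ 1
    leaf-shore-size {w} vw leaf =
      trans (countF-supported-at (vertexOf leaf) only-vertexOf)
            (cong bit (proj₂ (shore-induced vw (vertexOf leaf)) (side-vertexOf leaf ε)))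
      where
      only-vertexOf : ∀ g → shore w g ≡ true → g ≡ vertexOf leaf
      only-vertexOf g in-shore = leafOf-inj D (trans (leaf-side leaf (adj-sym vw) (proj₁ (shore-induced vw g) in-shore))
                                                     (sym (leafOf-vertexOf leaf)))

    vertex-beyond : ∀ {w} → Adj (T D) v w → Σ (Fin n) λ g → Side w v (leafOf D g)
    vertex-beyond vw = vertexOf is-leaf , side-vertexOf is-leaf side
      where open LeafBeyond (leaf-on-side tree-acyclic (adj-sym vw))

    distinct-branches : ∀ {w w′ g g′} → Adj (T D) v w → Adj (T D) v w′ → w ≢ w′ →
                        Side w v (leafOf D g) → Side w′ v (leafOf D g′) → g ≢ g′
    distinct-branches vw vw′ w≢w′ side side′ refl = w≢w′ (side-unique tree-acyclic (adj-sym vw) (adj-sym vw′) side side′)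

    two≤shore : ∀ {w} → Adj (T D) v w → deg (T D) w ≡ 3 → 2 ≤ countF (shore w)
    two≤shore {w} vw deg≡3 =
      two≤countF (in-shore (side-vertexOf leaf₁ side₁)) (in-shore (side-vertexOf leaf₂ side₂))
                 (λ g₁≡g₂ → l₁≢l₂ (trans (sym (leafOf-vertexOf leaf₁)) (trans (cong (leafOf D) g₁≡g₂) (leafOf-vertexOf leaf₂))))
      where
      open LeafPair (two-leaves-on-side tree-acyclic deg≡3 (adj-sym vw))
      in-shore : ∀ {g} → Side w v (leafOf D g) → shore w g ≡ true
      in-shore = proj₂ (shore-induced vw _)

    two≤co-shore : (t : Three (adj (T D) v)) → 2 ≤ countF (not ∘ shore (x t))
    two≤co-shore t with vertex-beyond (fy t) | vertex-beyond (fz t)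
    ... | g , side-g | g′ , side-g′ =
      two≤countF (off-shore (fy t) (x≢y t ∘ sym) side-g) (off-shore (fz t) (z≢x t) side-g′)
                 (distinct-branches (fy t) (fz t) (y≢z t) side-g side-g′)
      where
      off-shore : ∀ {w′ g} → Adj (T D) v w′ → w′ ≢ x t → Side w′ v (leafOf D g) → not (shore (x t) g) ≡ true
      off-shore {w′} vw′ w′≢x side = cong not (trans (shore-of-side vw′ side) (dec-false (w′ ≟ x t) w′≢x))

    shore-parity : (t : Three (adj (T D) v)) → odd (countF (shore (x t))) ≡ (deg (T D) (x t) ≡ᵇ 1)
    shore-parity t with deg (T D) (x t) ≡ᵇ 1 in leaf?
    ... | true  = cong odd (leaf-shore-size (fx t) (≡ᵇ⇒≡ _ 1 (subst Bool.T (sym leaf?) tt)))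
    ... | false with odd (countF (shore (x t))) in odd-shore
    ...   | false = refl
    ...   | true  = ⊥-elim (no-tight-cut S (two≤shore (fx t) deg≡3 , two≤co-shore t)
                              (tight-if-odd S odd-shore (width≤2 _ _ (adj-sym (fx t)) S (shore-induced (fx t)))))
      where
      S = shore (x t)
      deg≡3 = non-leaf-degree _ (λ deg≡1 → case trans (sym leaf?) (cong (_≡ᵇ 1) deg≡1) of λ ())

    spine-degree-1-or-3 : spineDeg (T D) v ≡ 1 ⊎ spineDeg (T D) v ≡ 3
    spine-degree-1-or-3 =
      subst (λ s → s ≡ 1 ⊎ s ≡ 3) (sym (countF-∧-three t (λ w → not (deg (T D) w ≡ᵇ 1))))
            (even-parity-of-three (leaf? (x t)) (leaf? (y t)) (leaf? (z t)) leaf-neighbours-even)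
      where
      t = three-of-count deg-v≡3
      leaf? : Fin (m D) → Bool
      leaf? w = deg (T D) w ≡ᵇ 1
      size : Fin (m D) → ℕ
      size w = countF (shore w)
      some-matching : PerfectMatching G
      some-matching with vertex-beyond (fx t) | vertex-beyond (fy t)
      ... | g , side-g | g′ , side-g′ =
        perfectMatching-exists matching-covered (distinct-branches (fx t) (fy t) (x≢y t) side-g side-g′)
      leaf-neighbours-even : leaf? (x t) xor (leaf? (y t) xor leaf? (z t)) ≡ false
      leaf-neighbours-even = begin
        leaf? (x t) xor (leaf? (y t) xor leaf? (z t))
          ≡⟨ cong₂ _xor_ (shore-parity t) (cong₂ _xor_ (shore-parity (rotate t)) (shore-parity (rotate (rotate t)))) ⟨
        odd (size (x t)) xor (odd (size (y t)) xor odd (size (z t)))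
          ≡⟨ trans (odd-+ (size (x t)) _) (cong (odd (size (x t)) xor_) (odd-+ (size (y t)) (size (z t)))) ⟨
        odd (size (x t) + (size (y t) + size (z t)))
          ≡⟨ cong odd (countF-partition₃ (shore (x t)) (shore (y t)) (shore (z t)) one-shore) ⟩
        odd n
          ≡⟨ even-order some-matching ⟩
        false ∎
        where
        open ≡-Reasoning
        one-shore : ∀ g → bit (shore (x t) g) + (bit (shore (y t) g) + bit (shore (z t) g)) ≡ 1
        one-shore g = ≐-one-hot (x≢y t) (y≢z t) (z≢x t) (covers t _ (proj₁ (branch-spec (leafOf D g) (leaf-≢-v g))))

lemma9 : ∀ {n : ℕ} (G : Graph n) → IsBrick G ⊎ IsBrace G → PmwEq G 2 →
         (D : PMDecomposition G) → WidthEq D 2 → SpineCubic (T D)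
lemma9 G brick-or-brace _ D (width≤2 , _) v ¬leaf spine≢1 =
  [ ⊥-elim ∘ spine≢1 , id ]′ (WidthTwo.spine-degree-1-or-3 matching-covered no-tight-cut D width≤2 (proj₂ (cubic D) v ¬leaf))
  where
  matching-covered : MatchingCovered G
  matching-covered = [ proj₁ , proj₁ ]′ brick-or-brace
  no-tight-cut : NoNontrivialTightCut G
  no-tight-cut = [ proj₂ ∘ proj₂ , proj₂ ∘ proj₂ ]′ brick-or-brace
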